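{- Let $D$ be a $3$-anti-circulant digraph such that every proper induced subdigraph of $D$ satisfies the BE-property, and let $S$ be a maximum stable set of $D$. Let $v_1\leftrightarrow v_2$ be a digon with $v_1,v_2\notin S$. If there is a vertex $v_3\in V(D)\setminus\{v_1,v_2\}$ with $v_3\in S$ such that $D[\{v_1,v_2,v_3\}]$ contains a directed cycle of length $3$, then $D$ admits an $S_{BE}$-path partition.
   Context: Digraphs are finite, loopless, without multiple arcs; $u\to v$ means $uv$ is an arc, and $u\leftrightarrow v$ (a digon) means both $u\to v$ and $v\to u$. A stable set is a set of pairwise non-adjacent vertices. A path partition is a collection of vertex-disjoint (directed) paths covering $V(D)$. For a stable set $S$, an $S_{BE}$-path partition is a path partition in which each path contains exactly one vertex of $S$ and that vertex is the first or last vertex of the path. A digraph satisfies the BE-property if for every maximum stable set $S$ it admits an $S_{BE}$-path partition. An anti-$P_4$ is a set of four distinct vertices with $v_1\to v_2$, $v_3\to v_2$, $v_3\to v_4$; $D$ is $3$-anti-circulant if for every such anti-$P_4$, $v_4\to v_1$. -}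

module Defs where

open import Data.Nat using (ℕ; _≤_)
open import Data.Fin using (Fin)
open import Data.Fin.Subset using (Subset; _∈_; _∉_; _⊆_; _⊂_; ⊤; ∣_∣)
open import Data.Fin.Subset.Properties using (_∈?_)
open import Data.List using (List; []; _∷_; _∷ʳ_; concat; length; filter)
open import Data.List.Relation.Unary.All using (All)
open import Data.List.Relation.Unary.Unique.Propositional using (Unique)
import Data.List.Membership.Propositional as LM
open import Data.Product using (Σ; ∃; _×_; _,_)
open import Data.Sum using (_⊎_)
open import Relation.Nullary using (¬_)
open import Relation.Binary.PropositionalEquality using (_≡_; _≢_)
open import Function.Bundles using (_⇔_)

record Digraph : Set₁ where
  field
    n    : ℕ
    _⇒_  : Fin n → Fin n → Set
    loopless : ∀ v → ¬ (v ⇒ v)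
open Digraph public

module _ (D : Digraph) where
  private
    V = Fin (n D)
    _⟶_ = _⇒_ D

  Digon : V → V → Set
  Digon u v = (u ⟶ v) × (v ⟶ u)

  AntiP4 : V → V → V → V → Set
  AntiP4 a b c d =
    (a ≢ b) × (a ≢ c) × (a ≢ d) × (b ≢ c) × (b ≢ d) × (c ≢ d) ×
    (a ⟶ b) × (c ⟶ b) × (c ⟶ d)

  ThreeAntiCirculant : Set
  ThreeAntiCirculant = ∀ a b c d → AntiP4 a b c d → d ⟶ a

  -- D[{a,b,c}] contains a directed cycle of length 3
  -- (the only possible 3-cycles on {a,b,c} are a→b→c→a and a→c→b→a)
  Cycle3 : V → V → V → Set
  Cycle3 a b c = ((a ⟶ b) × (b ⟶ c) × (c ⟶ a)) ⊎ ((a ⟶ c) × (c ⟶ b) × (b ⟶ a))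

  -- All notions below are for the induced subdigraph D[X], X ⊆ V(D).

  Stable : Subset (n D) → Subset (n D) → Set
  Stable X S = S ⊆ X × (∀ u v → u ∈ S → v ∈ S → ¬ (u ⟶ v))

  MaxStable : Subset (n D) → Subset (n D) → Set
  MaxStable X S = Stable X S × (∀ T → Stable X T → ∣ T ∣ ≤ ∣ S ∣)

  data Walk : List V → Set where
    single : ∀ v → Walk (v ∷ [])
    step   : ∀ {u v vs} → u ⟶ v → Walk (v ∷ vs) → Walk (u ∷ v ∷ vs)

  IsPath : List V → Set
  IsPath P = Walk P × Unique P

  PathPartition : Subset (n D) → List (List V) → Set
  PathPartition X Ps =
    All IsPath Ps × Unique (concat Ps) × (∀ v → (v LM.∈ concat Ps) ⇔ (v ∈ X))

  BEPath : Subset (n D) → List V → Set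
  BEPath S P =
    (length (filter (λ v → v ∈? S) P) ≡ 1) ×
    (∃ λ v → v ∈ S × ((∃ λ rest → P ≡ v ∷ rest) ⊎ (∃ λ rest → P ≡ rest ∷ʳ v)))

  SBEPathPartition : Subset (n D) → Subset (n D) → List (List V) → Set
  SBEPathPartition X S Ps = PathPartition X Ps × All (BEPath S) Ps

  BEProperty : Subset (n D) → Set
  BEProperty X = ∀ S → MaxStable X S → ∃ λ Ps → SBEPathPartition X S Ps

  ProperInducedBE : Set
  ProperInducedBE = ∀ X → X ⊂ ⊤ → BEProperty X

-- Delete the digon {v₁, v₂}. Since S avoids it, S stays a maximum stable set of the
-- proper subdigraph D − {v₁, v₂}, which therefore has an S_BE-path partition; let P be
-- its path through v₃, necessarily at one of its ends. Three-anti-circulance turns an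
-- arc x → y off the digon into a relay: if x sends an arc into the digon then so does y,
-- and if the digon sends an arc to y then it also sends one to x. The 3-cycle through v₃
-- starts both relays at v₃, so the other end of P is joined to the digon, and going once
-- around the digon adds v₁ and v₂ to P while keeping v₃ as its only vertex of S.
module Submission where

open import Defs
open import Data.Fin using (Fin)
open import Data.Fin.Subset using (Subset; _∈_; _∉_; _⊆_; _⊂_; ⊤; ∁; _∪_; ⁅_⁆)
open import Data.Fin.Subset.Properties
  using (∈⊤; _∈?_; x∉∁p⇒x∈p; x∉p⇒x∈∁p; x∈p⇒x∉∁p; x∈p∪q⁺; x∈p∪q⁻; x∈⁅y⁆⇔x≡y)
open import Data.List using (List; []; _∷_; _++_; _∷ʳ_; concat; length; filter)
open import Data.List.Properties using (filter-++; filter-none; ++-identityʳ; concat-++)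
import Data.List.Properties as List
open import Data.List.Relation.Unary.All as All using (All; []; _∷_)
import Data.List.Relation.Unary.All.Properties as All
open import Data.List.Relation.Unary.Any using (Any; here; there)
import Data.List.Relation.Unary.Any.Properties as Any
open import Data.List.Relation.Unary.AllPairs using ([]; _∷_)
open import Data.List.Relation.Unary.Unique.Propositional using (Unique)
import Data.List.Relation.Unary.Unique.Propositional.Properties as Unique
open import Data.List.Relation.Binary.Disjoint.Propositional using (Disjoint)
open import Data.List.Membership.Propositional using () renaming (_∈_ to _∈ₗ_)
open import Data.List.Membership.Propositional.Properties
  using (∈-++⁺ˡ; ∈-++⁺ʳ; ∈-∃++; ∈-concat⁺′; ∈-concat⁻′; ∈-filter⁺)
open import Data.List.Relation.Binary.Permutation.Propositional
  using (_↭_; ↭-refl; ↭-sym; ↭-swap; ↭⇒↭ₛ; module PermutationReasoning)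
open import Data.List.Relation.Binary.Permutation.Propositional.Properties
  using (All-resp-↭; ∈-resp-↭; ++⁺ˡ; ++⁺ʳ; shifts; ++-comm)
import Data.List.Relation.Binary.Permutation.Setoid.Properties as SetoidPermutation
open import Data.Product using (∃; ∃₂; _×_; _,_; proj₁; proj₂; map₂; swap)
open import Data.Sum using (_⊎_; inj₁; inj₂; [_,_]) renaming (map to ⊎-map)
open import Function using (_∘_)
open import Function.Bundles using (_⇔_; mk⇔; Equivalence)
open import Relation.Nullary using (Dec; yes; no)
open import Relation.Binary.PropositionalEquality
  using (_≡_; _≢_; refl; sym; cong; ≢-sym; setoid)

open Equivalence using (to; from)

module _ {A : Set} where

  Unique-resp-↭ : ∀ {xs ys : List A} → xs ↭ ys → Unique xs → Unique ys
  Unique-resp-↭ p = SetoidPermutation.Unique-resp-↭ (setoid A) (↭⇒↭ₛ p)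

  ∈-length≡1⇒≡ : ∀ {xs : List A} {x y} → length xs ≡ 1 → x ∈ₗ xs → y ∈ₗ xs → x ≡ y
  ∈-length≡1⇒≡ {_ ∷ []} _ (here refl) (here refl) = refl

  ∈-pair⇔ : ∀ {x a b : A} → x ∈ₗ a ∷ b ∷ [] ⇔ (x ≡ a ⊎ x ≡ b)
  ∈-pair⇔ = mk⇔ (λ { (here x≡a)         → inj₁ x≡a
                   ; (there (here x≡b)) → inj₂ x≡b
                   ; (there (there ())) })
                [ here , there ∘ here ]

  All-replace : ∀ {P : A → Set} xs {x y ys} →
                All P (xs ++ x ∷ ys) → P y → All P (xs ++ y ∷ ys)
  All-replace xs all py with All.++⁻ xs all
  ... | all-xs , _ ∷ all-ys = All.++⁺ all-xs (py ∷ all-ys)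

  concat-replace-↭ : ∀ (xss : List (List A)) {xs ys ws} yss → ys ↭ ws ++ xs →
                     concat (xss ++ ys ∷ yss) ↭ ws ++ concat (xss ++ xs ∷ yss)
  concat-replace-↭ xss {xs} {ys} {ws} yss ys↭ = begin
    concat (xss ++ ys ∷ yss)             ≡⟨ concat-++ xss (ys ∷ yss) ⟨
    concat xss ++ ys ++ concat yss       ↭⟨ ++⁺ˡ (concat xss) (++⁺ʳ (concat yss) ys↭) ⟩
    concat xss ++ (ws ++ xs) ++ concat yss
      ≡⟨ cong (concat xss ++_) (List.++-assoc ws xs (concat yss)) ⟩
    concat xss ++ ws ++ xs ++ concat yss ↭⟨ shifts (concat xss) ws ⟩
    ws ++ concat xss ++ xs ++ concat yss ≡⟨ cong (ws ++_) (concat-++ xss (xs ∷ yss)) ⟩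
    ws ++ concat (xss ++ xs ∷ yss)       ∎
    where open PermutationReasoning

module _ (D : Digraph) where

  private
    V : Set
    V = Fin (n D)

    _⟶_ : V → V → Set
    _⟶_ = _⇒_ D

  arc⇒≢ : ∀ {x y} → x ⟶ y → x ≢ y
  arc⇒≢ {x} x⟶x refl = loopless D x x⟶x

  MaxStable-restrict : ∀ {X S} → MaxStable D ⊤ S → S ⊆ X → MaxStable D X S
  MaxStable-restrict ((_ , stable) , maximum) S⊆X =
    (S⊆X , stable) , λ T T-stable → maximum T ((λ _ → ∈⊤) , proj₂ T-stable)

  PathPartition-⊆ : ∀ {X Ps P v} → PathPartition D X Ps → P ∈ₗ Ps → v ∈ₗ P → v ∈ X
  PathPartition-⊆ (_ , _ , cover) P∈Ps v∈P = to (cover _) (∈-concat⁺′ v∈P P∈Ps)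

  PathPartition-fill : ∀ {X} Ps₁ {P Ps₂ P' ws} →
    PathPartition D X (Ps₁ ++ P ∷ Ps₂) → Walk D P' → P' ↭ ws ++ P →
    Unique ws → (∀ v → v ∈ₗ ws ⇔ v ∉ X) → PathPartition D ⊤ (Ps₁ ++ P' ∷ Ps₂)
  PathPartition-fill {X} Ps₁ {P} {Ps₂} {P'} {ws}
    partition@(paths , unique , cover) walk P'↭ ws-unique ws-outside =
      All-replace Ps₁ paths (walk , Unique-resp-↭ (↭-sym P'↭) P'-unique)
    , Unique-resp-↭ (↭-sym concat↭)
        (Unique.++⁺ ws-unique unique (disjoint (to (cover _))))
    , λ v → mk⇔ (λ _ → ∈⊤) (λ _ → ∈-resp-↭ (↭-sym concat↭) (covered v))
    where
    concat↭ : concat (Ps₁ ++ P' ∷ Ps₂) ↭ ws ++ concat (Ps₁ ++ P ∷ Ps₂)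
    concat↭ = concat-replace-↭ Ps₁ Ps₂ P'↭

    disjoint : ∀ {xs} → (∀ {v} → v ∈ₗ xs → v ∈ X) → Disjoint ws xs
    disjoint xs⊆X (v∈ws , v∈xs) = to (ws-outside _) v∈ws (xs⊆X v∈xs)

    P∈Ps : P ∈ₗ Ps₁ ++ P ∷ Ps₂
    P∈Ps = ∈-++⁺ʳ Ps₁ (here refl)

    P'-unique : Unique (ws ++ P)
    P'-unique = Unique.++⁺ ws-unique (proj₂ (All.lookup paths P∈Ps))
                  (disjoint (PathPartition-⊆ partition P∈Ps))

    covered : ∀ v → v ∈ₗ ws ++ concat (Ps₁ ++ P ∷ Ps₂)
    covered v with v ∈? X
    ... | yes v∈X = ∈-++⁺ʳ ws (from (cover v) v∈X)
    ... | no v∉X  = ∈-++⁺ˡ (from (ws-outside v) v∉X)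

  module _ (S : Subset (n D)) where

    private
      S? : ∀ v → Dec (v ∈ S)
      S? = _∈? S

    BEPath-endpoint : ∀ {P v} → BEPath D S P → v ∈ₗ P → v ∈ S →
                      (∃ λ rest → P ≡ v ∷ rest) ⊎ (∃ λ rest → P ≡ rest ∷ʳ v)
    BEPath-endpoint {P} (one , u , u∈S , ends) v∈P v∈S
      with ∈-length≡1⇒≡ one (∈-filter⁺ S? (endpoint-∈ ends) u∈S)
                            (∈-filter⁺ S? v∈P v∈S)
      where
      endpoint-∈ : ((∃ λ rest → P ≡ u ∷ rest) ⊎ (∃ λ rest → P ≡ rest ∷ʳ u)) → u ∈ₗ P
      endpoint-∈ (inj₁ (_ , refl))    = here refl
      endpoint-∈ (inj₂ (rest , refl)) = ∈-++⁺ʳ rest (here refl)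
    ... | refl = ends

    BEPath-++ʳ : ∀ {s rest ws} → BEPath D S (s ∷ rest) → s ∈ S → All (_∉ S) ws →
                 BEPath D S (s ∷ rest ++ ws)
    BEPath-++ʳ {s} {rest} {ws} (one , _) s∈S ws∉S =
      count , s , s∈S , inj₁ (rest ++ ws , refl)
      where
      count : length (filter S? (s ∷ rest ++ ws)) ≡ 1
      count rewrite filter-++ S? (s ∷ rest) ws | filter-none S? ws∉S
                  | ++-identityʳ (filter S? (s ∷ rest)) = one

    BEPath-++ˡ : ∀ {s rest ws} → BEPath D S (rest ∷ʳ s) → s ∈ S → All (_∉ S) ws →
                 BEPath D S (ws ++ rest ∷ʳ s)
    BEPath-++ˡ {s} {rest} {ws} (one , _) s∈S ws∉S =
      count , s , s∈S , inj₂ (ws ++ rest , sym (List.++-assoc ws rest (s ∷ [])))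
      where
      count : length (filter S? (ws ++ rest ∷ʳ s)) ≡ 1
      count rewrite filter-++ S? ws (rest ∷ʳ s) | filter-none S? ws∉S = one

  module _ (v₁ v₂ : V) where

    AvoidsDigon : V → Set
    AvoidsDigon x = x ≢ v₁ × x ≢ v₂

    IntoDigon : V → Set
    IntoDigon x = (x ⟶ v₁) ⊎ (x ⟶ v₂)

    OutOfDigon : V → Set
    OutOfDigon x = (v₁ ⟶ x) ⊎ (v₂ ⟶ x)

    OffDigon : Subset (n D)
    OffDigon = ∁ (⁅ v₁ ⁆ ∪ ⁅ v₂ ⁆)

    Cycle3⇒IntoDigon : ∀ {x} → Cycle3 D v₁ v₂ x → IntoDigon x
    Cycle3⇒IntoDigon (inj₁ (_ , _ , x⟶v₁)) = inj₁ x⟶v₁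
    Cycle3⇒IntoDigon (inj₂ (_ , x⟶v₂ , _)) = inj₂ x⟶v₂

    Cycle3⇒OutOfDigon : ∀ {x} → Cycle3 D v₁ v₂ x → OutOfDigon x
    Cycle3⇒OutOfDigon (inj₁ (_ , v₂⟶x , _)) = inj₂ v₂⟶x
    Cycle3⇒OutOfDigon (inj₂ (v₁⟶x , _ , _)) = inj₁ v₁⟶x

    ∉OffDigon⇔≡⊎≡ : ∀ {x} → x ∉ OffDigon ⇔ (x ≡ v₁ ⊎ x ≡ v₂)
    ∉OffDigon⇔≡⊎≡ = mk⇔
      (⊎-map (to x∈⁅y⁆⇔x≡y) (to x∈⁅y⁆⇔x≡y) ∘ x∈p∪q⁻ _ _ ∘ x∉∁p⇒x∈p)
      (x∈p⇒x∉∁p ∘ x∈p∪q⁺ ∘ ⊎-map (from x∈⁅y⁆⇔x≡y) (from x∈⁅y⁆⇔x≡y))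

    ∈OffDigon⇒AvoidsDigon : ∀ {x} → x ∈ OffDigon → AvoidsDigon x
    ∈OffDigon⇒AvoidsDigon x∈X =
        (λ x≡v₁ → from ∉OffDigon⇔≡⊎≡ (inj₁ x≡v₁) x∈X)
      , (λ x≡v₂ → from ∉OffDigon⇔≡⊎≡ (inj₂ x≡v₂) x∈X)

    ⊆OffDigon : ∀ {S} → v₁ ∉ S → v₂ ∉ S → S ⊆ OffDigon
    ⊆OffDigon v₁∉S v₂∉S x∈S =
      x∉p⇒x∈∁p ( [ (λ { refl → v₁∉S x∈S }) , (λ { refl → v₂∉S x∈S }) ]
               ∘ to ∉OffDigon⇔≡⊎≡ ∘ x∈p⇒x∉∁p)

    OffDigon⊂⊤ : OffDigon ⊂ ⊤
    OffDigon⊂⊤ = (λ _ → ∈⊤) , v₁ , ∈⊤ , from ∉OffDigon⇔≡⊎≡ (inj₁ refl)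

    ↭Digon⇒∈⇔∉OffDigon : ∀ {ws} → ws ↭ v₁ ∷ v₂ ∷ [] → ∀ v → v ∈ₗ ws ⇔ v ∉ OffDigon
    ↭Digon⇒∈⇔∉OffDigon ws↭ v = mk⇔
      (from ∉OffDigon⇔≡⊎≡ ∘ to ∈-pair⇔ ∘ ∈-resp-↭ ws↭)
      (∈-resp-↭ (↭-sym ws↭) ∘ from ∈-pair⇔ ∘ to ∉OffDigon⇔≡⊎≡)

  module _ (anti : ThreeAntiCirculant D) where

    Digon-relayIn : ∀ {a b x y} → Digon D a b → x ⟶ y →
                    x ≢ a → x ≢ b → y ≢ a → y ≢ b → x ⟶ a → y ⟶ b
    Digon-relayIn (a⟶b , b⟶a) x⟶y x≢a x≢b y≢a y≢b x⟶a =
      anti _ _ _ _ ( arc⇒≢ b⟶a , ≢-sym x≢b , ≢-sym y≢b , ≢-sym x≢a , ≢-sym y≢a , arc⇒≢ x⟶y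
                   , b⟶a , x⟶a , x⟶y)

    Digon-relayOut : ∀ {a b x y} → Digon D a b → x ⟶ y →
                     x ≢ a → x ≢ b → y ≢ a → y ≢ b → a ⟶ y → b ⟶ x
    Digon-relayOut (a⟶b , b⟶a) x⟶y x≢a x≢b y≢a y≢b a⟶y =
      anti _ _ _ _ (arc⇒≢ x⟶y , x≢a , x≢b , y≢a , y≢b , arc⇒≢ a⟶b , x⟶y , a⟶y , a⟶b)

    module _ {v₁ v₂} (v₁↔v₂ : Digon D v₁ v₂) where

      IntoDigon-relay : ∀ {x y} → x ⟶ y → AvoidsDigon v₁ v₂ x → AvoidsDigon v₁ v₂ y →
                        IntoDigon v₁ v₂ x → IntoDigon v₁ v₂ y
      IntoDigon-relay x⟶y (x≢v₁ , x≢v₂) (y≢v₁ , y≢v₂) (inj₁ x⟶v₁) =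
        inj₂ (Digon-relayIn v₁↔v₂ x⟶y x≢v₁ x≢v₂ y≢v₁ y≢v₂ x⟶v₁)
      IntoDigon-relay x⟶y (x≢v₁ , x≢v₂) (y≢v₁ , y≢v₂) (inj₂ x⟶v₂) =
        inj₁ (Digon-relayIn (swap v₁↔v₂) x⟶y x≢v₂ x≢v₁ y≢v₂ y≢v₁ x⟶v₂)

      OutOfDigon-relay : ∀ {x y} → x ⟶ y → AvoidsDigon v₁ v₂ x → AvoidsDigon v₁ v₂ y →
                         OutOfDigon v₁ v₂ y → OutOfDigon v₁ v₂ x
      OutOfDigon-relay x⟶y (x≢v₁ , x≢v₂) (y≢v₁ , y≢v₂) (inj₁ v₁⟶y) =
        inj₂ (Digon-relayOut v₁↔v₂ x⟶y x≢v₁ x≢v₂ y≢v₁ y≢v₂ v₁⟶y)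
      OutOfDigon-relay x⟶y (x≢v₁ , x≢v₂) (y≢v₁ , y≢v₂) (inj₂ v₂⟶y) =
        inj₁ (Digon-relayOut (swap v₁↔v₂) x⟶y x≢v₂ x≢v₁ y≢v₂ y≢v₁ v₂⟶y)

      OutOfDigon-head : ∀ {x xs} → Walk D (x ∷ xs) → All (AvoidsDigon v₁ v₂) (x ∷ xs) →
                        Any (OutOfDigon v₁ v₂) (x ∷ xs) → OutOfDigon v₁ v₂ x
      OutOfDigon-head _ _ (here out) = out
      OutOfDigon-head (step x⟶y walk) (x-avoids ∷ avoids) (there out) =
        OutOfDigon-relay x⟶y x-avoids (All.head avoids) (OutOfDigon-head walk avoids out)

      Walk-++Digon : ∀ {x} xs → Walk D (x ∷ xs) → All (AvoidsDigon v₁ v₂) (x ∷ xs) →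
                     IntoDigon v₁ v₂ x →
                     ∃ λ ws → ws ↭ v₁ ∷ v₂ ∷ [] × Walk D (x ∷ xs ++ ws)
      Walk-++Digon [] _ _ (inj₁ x⟶v₁) =
        _ , ↭-refl , step x⟶v₁ (step (proj₁ v₁↔v₂) (single v₂))
      Walk-++Digon [] _ _ (inj₂ x⟶v₂) =
        _ , ↭-swap v₂ v₁ ↭-refl , step x⟶v₂ (step (proj₂ v₁↔v₂) (single v₁))
      Walk-++Digon (y ∷ ys) (step x⟶y walk) (x-avoids ∷ avoids) into =
        map₂ (map₂ (step x⟶y))
          (Walk-++Digon ys walk avoids (IntoDigon-relay x⟶y x-avoids (All.head avoids) into))

      OutOfDigon⇒Digon++Walk : ∀ {x xs} → Walk D (x ∷ xs) → OutOfDigon v₁ v₂ x →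
                               ∃ λ ws → ws ↭ v₁ ∷ v₂ ∷ [] × Walk D (ws ++ x ∷ xs)
      OutOfDigon⇒Digon++Walk walk (inj₁ v₁⟶x) =
        _ , ↭-swap v₂ v₁ ↭-refl , step (proj₂ v₁↔v₂) (step v₁⟶x walk)
      OutOfDigon⇒Digon++Walk walk (inj₂ v₂⟶x) =
        _ , ↭-refl , step (proj₁ v₁↔v₂) (step v₂⟶x walk)

      Digon++Walk : ∀ xs {x} → Walk D (xs ∷ʳ x) → All (AvoidsDigon v₁ v₂) (xs ∷ʳ x) →
                    OutOfDigon v₁ v₂ x →
                    ∃ λ ws → ws ↭ v₁ ∷ v₂ ∷ [] × Walk D (ws ++ xs ∷ʳ x)
      Digon++Walk []       walk _      out = OutOfDigon⇒Digon++Walk walk out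
      Digon++Walk (y ∷ ys) walk avoids out =
        OutOfDigon⇒Digon++Walk walk (OutOfDigon-head walk avoids (Any.++⁺ʳ (y ∷ ys) (here out)))

      BEPath-absorbDigon : ∀ S {P s} → v₁ ∉ S → v₂ ∉ S →
        BEPath D S P → Walk D P → All (AvoidsDigon v₁ v₂) P →
        s ∈ₗ P → s ∈ S → IntoDigon v₁ v₂ s → OutOfDigon v₁ v₂ s →
        ∃₂ λ P' ws → ws ↭ v₁ ∷ v₂ ∷ [] × P' ↭ ws ++ P × Walk D P' × BEPath D S P'
      BEPath-absorbDigon S v₁∉S v₂∉S BE walk avoids s∈P s∈S into out
        with BEPath-endpoint S BE s∈P s∈S
      ... | inj₁ (rest , refl) =
        let ws , ws↭ , walk' = Walk-++Digon rest walk avoids into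
        in _ , ws , ws↭ , ++-comm (_ ∷ rest) ws , walk'
             , BEPath-++ʳ S BE s∈S (All-resp-↭ (↭-sym ws↭) (v₁∉S ∷ v₂∉S ∷ []))
      ... | inj₂ (rest , refl) =
        let ws , ws↭ , walk' = Digon++Walk rest walk avoids out
        in _ , ws , ws↭ , ↭-refl , walk'
             , BEPath-++ˡ S BE s∈S (All-resp-↭ (↭-sym ws↭) (v₁∉S ∷ v₂∉S ∷ []))

      SBEPathPartition-absorbDigon : ∀ S {Ps s} → v₁ ∉ S → v₂ ∉ S →
        SBEPathPartition D (OffDigon v₁ v₂) S Ps →
        s ∈ S → IntoDigon v₁ v₂ s → OutOfDigon v₁ v₂ s →
        ∃ λ Ps' → SBEPathPartition D ⊤ S Ps'
      SBEPathPartition-absorbDigon S {Ps} {s} v₁∉S v₂∉S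
        (partition@(paths , _ , cover) , BEs) s∈S into out
        with P , s∈P , P∈Ps ← ∈-concat⁻′ Ps (from (cover s) (⊆OffDigon v₁ v₂ v₁∉S v₂∉S s∈S))
        with Ps₁ , Ps₂ , refl ← ∈-∃++ P∈Ps =
        let avoids = All.tabulate (∈OffDigon⇒AvoidsDigon v₁ v₂ ∘ PathPartition-⊆ partition P∈Ps)
            P' , ws , ws↭ , P'↭ , walk , BE = BEPath-absorbDigon S v₁∉S v₂∉S
              (All.lookup BEs P∈Ps) (proj₁ (All.lookup paths P∈Ps)) avoids s∈P s∈S into out
        in _ , PathPartition-fill Ps₁ partition walk P'↭
                 (Unique-resp-↭ (↭-sym ws↭) ((arc⇒≢ (proj₁ v₁↔v₂) ∷ []) ∷ [] ∷ []))
                 (↭Digon⇒∈⇔∉OffDigon v₁ v₂ ws↭)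
             , All-replace Ps₁ BEs BE

-- The hypotheses v₃ ≢ v₁ and v₃ ≢ v₂ are implied by v₃ ∈ S.
lemma11 : (D : Digraph) → ThreeAntiCirculant D → ProperInducedBE D →
          (S : Subset (n D)) → MaxStable D ⊤ S →
          (v₁ v₂ : Fin (n D)) → Digon D v₁ v₂ → v₁ ∉ S → v₂ ∉ S →
          (v₃ : Fin (n D)) → v₃ ≢ v₁ → v₃ ≢ v₂ → v₃ ∈ S →
          Cycle3 D v₁ v₂ v₃ →
          ∃ λ (Ps : List (List (Fin (n D)))) → SBEPathPartition D ⊤ S Ps
lemma11 D anti proper S S-max v₁ v₂ v₁↔v₂ v₁∉S v₂∉S v₃ _ _ v₃∈S cycle =
  let S-maxOff = MaxStable-restrict D S-max (⊆OffDigon D v₁ v₂ v₁∉S v₂∉S)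
      _ , partition = proper (OffDigon D v₁ v₂) (OffDigon⊂⊤ D v₁ v₂) S S-maxOff
  in SBEPathPartition-absorbDigon D anti v₁↔v₂ S v₁∉S v₂∉S partition v₃∈S
       (Cycle3⇒IntoDigon D v₁ v₂ cycle) (Cycle3⇒OutOfDigon D v₁ v₂ cycle)
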